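{- For every $n\ge 0$, the number of LCO forests of size $n$ equals the Catalan number $C_n=\frac{1}{n+1}\binom{2n}{n}$, and the number of LCO forests of size $n+1$ consisting of exactly one tree also equals $C_n$.
   Context: An LCO forest is a finite (possibly empty) list of ordered (plane) rooted trees, where a tree may consist of a root only, such that: no vertex has exactly one child; each vertex is labeled with an integer composition whose last entry is $1$; each vertex that has at least one child and whose label composition has size (sum of entries) at least $2$ is additionally colored either $top$ or $bot$; and every leaf (a vertex with a parent but no children) that is the rightmost child of its parent has a label composition of size at least $2$. The size of an LCO forest is the sum of the sizes of all its label compositions. -}

module Defs where

open import Data.Nat using (ℕ; zero; suc; _+_; _*_; _≤ᵇ_; _≡ᵇ_)
open import Data.Nat.DivMod using (_/_)
open import Data.Nat.Combinatorics using (_C_)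
open import Data.Bool using (Bool; true; false; _∧_; if_then_else_; T)
open import Data.List using (List; []; _∷_; length)
open import Data.Nat.ListAction using (sum)
open import Data.Maybe using (Maybe; just; nothing; is-just; is-nothing)
open import Data.Product using (Σ; _×_)
open import Relation.Binary.PropositionalEquality using (_≡_)

catalan : ℕ → ℕ
catalan n = ((2 * n) C n) / suc n

-- An integer composition is a list of positive integers; its size is its sum.
Composition : Set
Composition = List ℕ

compSize : Composition → ℕ
compSize = sum

lastIsOne : List ℕ → Bool
lastIsOne []           = false
lastIsOne (x ∷ [])     = x ≡ᵇ 1
lastIsOne (_ ∷ y ∷ ys) = lastIsOne (y ∷ ys)

allPositive : List ℕ → Bool
allPositive []       = true
allPositive (x ∷ xs) = (1 ≤ᵇ x) ∧ allPositive xs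

okLabel : Composition → Bool
okLabel c = allPositive c ∧ lastIsOne c

data Color : Set where
  top bot : Color

data Tree : Set where
  node : Composition → Maybe Color → List Tree → Tree

Forest : Set
Forest = List Tree

okArity : List Tree → Bool
okArity []           = true
okArity (_ ∷ [])     = false
okArity (_ ∷ _ ∷ _)  = true

okColor : Composition → Maybe Color → List Tree → Bool
okColor c col []      = is-nothing col
okColor c col (_ ∷ _) = if 2 ≤ᵇ compSize c then is-just col else is-nothing col

rightLeafOK : Tree → Bool
rightLeafOK (node c _ [])      = 2 ≤ᵇ compSize c
rightLeafOK (node _ _ (_ ∷ _)) = true

lastChildOK : Tree → List Tree → Bool
lastChildOK t []      = rightLeafOK t
lastChildOK t (_ ∷ _) = true

mutual
  okTree : Tree → Bool
  okTree (node c col ts) = okLabel c ∧ okArity ts ∧ okColor c col ts ∧ okChildren ts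

  okChildren : List Tree → Bool
  okChildren []       = true
  okChildren (t ∷ ts) = okTree t ∧ lastChildOK t ts ∧ okChildren ts

-- roots are not leaves in the sense of the definition: no rightmost-leaf check
okForest : Forest → Bool
okForest []       = true
okForest (t ∷ ts) = okTree t ∧ okForest ts

mutual
  treeSize : Tree → ℕ
  treeSize (node c _ ts) = compSize c + forestSize ts

  forestSize : Forest → ℕ
  forestSize []       = 0
  forestSize (t ∷ ts) = treeSize t + forestSize ts

LCOForestOfSize : ℕ → Set
LCOForestOfSize n = Σ Forest (λ f → T (okForest f) × forestSize f ≡ n)

LCOTreeForestOfSize : ℕ → Set
LCOTreeForestOfSize n = Σ Forest (λ f → T (okForest f) × forestSize f ≡ n × length f ≡ 1)

-- Removing the first unit of the root label is a bijection from LCO trees of size n + 1 onto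
-- LCO forests of size n: a first part a ≥ 2 is decremented; a first part 1 is detached and
-- becomes a unit leaf (a single vertex labelled (1)) appended to the forest; and once the label
-- is (1) the root is deleted and its children form the forest. A label (1,1) has two colours
-- with children: bot is the case just described, while top stands for the composition (2),
-- whose decrement keeps the children under a root labelled (1). As forests are lists of trees,
-- the number B(n,k) of k-tuples of LCO forests of total size n satisfies
-- B(n+1,k+1) = B(n+1,k) + B(n,k+2): either the first forest is empty, or its first tree is
-- replaced by the forest it corresponds to. The ballot numbers k/(2n+k) · C(2n+k,n) satisfy the
-- same recurrence, and for k = 1 they are the Catalan numbers.
module Submission where

open import Defs
open import Data.Bool using (Bool; true; false; _∧_; not; T)
open import Data.Bool.Properties using (T-∧; T-≡; T-not-≡; T-irrelevant; ∧-assoc; ∧-identityʳ)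
open import Data.Empty using (⊥-elim)
open import Data.Fin using (Fin; zero)
open import Data.Fin.Properties using (+↔⊎)
open import Data.List using ([]; _∷_; _++_; replicate)
open import Data.List.Properties using (++-assoc; ++-identityʳ)
open import Data.Maybe using (just; nothing; is-nothing)
open import Data.Nat
open import Data.Nat.Combinatorics using (_C_; nCk+nC[k+1]≡[n+1]C[k+1]; nCk≡nC[n∸k])
open import Data.Nat.DivMod using (_/_; m*n/n≡m)
open import Data.Nat.Properties
open import Data.Nat.Tactic.RingSolver using (solve-∀)
open import Data.Product using (Σ; _×_; _,_; proj₁; proj₂)
open import Data.Sum using (_⊎_; inj₁; inj₂)
open import Data.Sum.Function.Propositional using (_⊎-↔_)
open import Data.Vec as Vec using (Vec; []; _∷_)
open import Function.Base using (_∘_)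
open import Function.Bundles using (_↔_; mk↔ₛ′; Equivalence)
open import Function.Properties.Inverse using (↔-trans; ↔-sym)
open import Relation.Binary.PropositionalEquality
open import Relation.Nullary.Irrelevant using (Irrelevant)

open Equivalence using (to; from)

-- Binomial coefficients and ballot numbers

[k+1]*[n+1]C[k+1]≡[n+1]*nCk : ∀ n k → suc k * (suc n C suc k) ≡ suc n * (n C k)
[k+1]*[n+1]C[k+1]≡[n+1]*nCk zero    zero    = refl
[k+1]*[n+1]C[k+1]≡[n+1]*nCk zero    (suc k) = *-zeroʳ (2 + k)
[k+1]*[n+1]C[k+1]≡[n+1]*nCk (suc n) k = begin
    suc k * (suc (suc n) C suc k)
  ≡⟨ cong (suc k *_) (nCk+nC[k+1]≡[n+1]C[k+1] (suc n) k) ⟨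
    suc k * (suc n C k + suc n C suc k)
  ≡⟨ *-distribˡ-+ (suc k) (suc n C k) _ ⟩
    suc k * (suc n C k) + suc k * (suc n C suc k)
  ≡⟨ cong (suc k * (suc n C k) +_) ([k+1]*[n+1]C[k+1]≡[n+1]*nCk n k) ⟩
    suc k * (suc n C k) + suc n * (n C k)
  ≡⟨ +-assoc (suc n C k) (k * (suc n C k)) _ ⟩
    suc n C k + (k * (suc n C k) + suc n * (n C k))
  ≡⟨ cong (suc n C k +_) (shifted k) ⟩
    suc n C k + suc n * (suc n C k)
  ∎
  where
  open ≡-Reasoning
  shifted : ∀ k → k * (suc n C k) + suc n * (n C k) ≡ suc n * (suc n C k)
  shifted zero    = refl
  shifted (suc j) = begin
      suc j * (suc n C suc j) + suc n * (n C suc j)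
    ≡⟨ cong (_+ suc n * (n C suc j)) ([k+1]*[n+1]C[k+1]≡[n+1]*nCk n j) ⟩
      suc n * (n C j) + suc n * (n C suc j)
    ≡⟨ *-distribˡ-+ (suc n) (n C j) _ ⟨
      suc n * (n C j + n C suc j)
    ≡⟨ cong (suc n *_) (nCk+nC[k+1]≡[n+1]C[k+1] n j) ⟩
      suc n * (suc n C suc j)
    ∎

[m+n]Cm≡[m+n]Cn : ∀ m n → (m + n) C m ≡ (m + n) C n
[m+n]Cm≡[m+n]Cn m n = begin
    (m + n) C m           ≡⟨ nCk≡nC[n∸k] (m≤m+n m n) ⟩
    (m + n) C (m + n ∸ m) ≡⟨ cong ((m + n) C_) (m+n∸m≡n m n) ⟩
    (m + n) C n           ∎
  where open ≡-Reasoning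

[m+1]*[m+n+1]C[m+1]≡[n+1]*[m+n+1]Cm : ∀ m n → suc m * (suc (m + n) C suc m) ≡ suc n * (suc (m + n) C m)
[m+1]*[m+n+1]C[m+1]≡[n+1]*[m+n+1]Cm m n = begin
    suc m * (suc (m + n) C suc m)   ≡⟨ [k+1]*[n+1]C[k+1]≡[n+1]*nCk (m + n) m ⟩
    suc (m + n) * ((m + n) C m)     ≡⟨ cong (suc (m + n) *_) ([m+n]Cm≡[m+n]Cn m n) ⟩
    suc (m + n) * ((m + n) C n)     ≡⟨ [k+1]*[n+1]C[k+1]≡[n+1]*nCk (m + n) n ⟨
    suc n * (suc (m + n) C suc n)   ≡⟨ cong (λ s → suc n * (s C suc n)) (+-suc m n) ⟨
    suc n * ((m + suc n) C suc n)   ≡⟨ cong (suc n *_) ([m+n]Cm≡[m+n]Cn m (suc n)) ⟨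
    suc n * ((m + suc n) C m)       ≡⟨ cong (λ s → suc n * (s C m)) (+-suc m n) ⟩
    suc n * (suc (m + n) C m)       ∎
  where open ≡-Reasoning

ballot : ℕ → ℕ → ℕ
ballot zero    k       = 1
ballot (suc n) zero    = 0
ballot (suc n) (suc k) = ballot (suc n) k + ballot n (suc (suc k))

private
  k+2[n+1]≡2+n+[n+k] : ∀ n k → k + (suc n + suc n) ≡ suc (suc (n + (n + k)))
  k+2[n+1]≡2+n+[n+k] = solve-∀

  k+2n≡n+[n+k] : ∀ n k → k + (n + n) ≡ n + (n + k)
  k+2n≡n+[n+k] = solve-∀

module _ (n k : ℕ) where

  private
    N : ℕ
    N = suc (suc (n + (n + k)))

  ballot-step-algebra : ∀ {B₁ B₂ X Y} → N * B₁ ≡ k * X → N * B₂ ≡ suc (suc k) * Y →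
                        suc n * X ≡ suc (suc (n + k)) * Y → suc N * (B₁ + B₂) ≡ suc k * (Y + X)
  ballot-step-algebra {B₁} {B₂} {X} {Y} h₁ h₂ ratio = *-cancelˡ-≡ _ _ N (begin
      N * (suc N * (B₁ + B₂))            ≡⟨ distrib (suc (n + (n + k))) B₁ B₂ ⟩
      suc N * (N * B₁ + N * B₂)          ≡⟨ cong₂ (λ a b → suc N * (a + b)) h₁ h₂ ⟩
      suc N * (k * X + suc (suc k) * Y)  ≡⟨ +-cancelʳ-≡ _ _ _ balanced ⟩
      N * (suc k * (Y + X))              ∎)
    where
    open ≡-Reasoning
    distrib : ∀ m a b → suc m * (suc (suc m) * (a + b)) ≡ suc (suc m) * (suc m * a + suc m * b)
    distrib = solve-∀
    -- The identity holds after adding 2 (n + 1) X to the left and 2 (n + k + 2) Y to the right,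
    -- two quantities that the ratio hypothesis equates; this avoids truncated subtraction.
    expand : ∀ n k X Y → suc (suc (suc (n + (n + k)))) * (k * X + suc (suc k) * Y) + 2 * (suc n * X)
                       ≡ suc (suc (n + (n + k))) * (suc k * (Y + X)) + 2 * (suc (suc (n + k)) * Y)
    expand = solve-∀
    balanced : suc N * (k * X + suc (suc k) * Y) + 2 * (suc n * X) ≡ N * (suc k * (Y + X)) + 2 * (suc n * X)
    balanced = trans (expand n k X Y) (cong (λ z → N * (suc k * (Y + X)) + 2 * z) (sym ratio))

  ballot-step : ∀ {B₁ B₂} →
    (k + (suc n + suc n)) * B₁ ≡ k * ((k + (suc n + suc n)) C suc n) →
    (suc (suc k) + (n + n)) * B₂ ≡ suc (suc k) * ((suc (suc k) + (n + n)) C n) →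
    (suc k + (suc n + suc n)) * (B₁ + B₂) ≡ suc k * ((suc k + (suc n + suc n)) C suc n)
  ballot-step {B₁} {B₂} h₁ h₂ rewrite k+2[n+1]≡2+n+[n+k] n k | k+2n≡n+[n+k] n k =
    trans (ballot-step-algebra {B₁} {B₂} h₁ h₂ ratio) (cong (suc k *_) (nCk+nC[k+1]≡[n+1]C[k+1] N n))
    where
    ratio : suc n * (N C suc n) ≡ suc (suc (n + k)) * (N C n)
    ratio = subst (λ s → suc n * (s C suc n) ≡ suc (suc (n + k)) * (s C n))
                  (cong suc (+-suc n (n + k))) ([m+1]*[m+n+1]C[m+1]≡[n+1]*[m+n+1]Cm n (suc (n + k)))

ballot-closed-form : ∀ n k → (k + (n + n)) * ballot n k ≡ k * ((k + (n + n)) C n)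
ballot-closed-form zero    k       = cong (_* 1) (+-identityʳ k)
ballot-closed-form (suc n) zero    = *-zeroʳ (suc n + suc n)
ballot-closed-form (suc n) (suc k) =
  ballot-step n k (ballot-closed-form (suc n) k) (ballot-closed-form n (suc (suc k)))

catalan≡ballot : ∀ n → catalan n ≡ ballot n 1
catalan≡ballot n = begin
    ((2 * n) C n) / suc n        ≡⟨ cong (λ m → (m C n) / suc n) (cong (n +_) (+-identityʳ n)) ⟩
    ((n + n) C n) / suc n        ≡⟨ cong (_/ suc n) ballot*[n+1]≡2nCn ⟨
    ballot n 1 * suc n / suc n  ≡⟨ m*n/n≡m (ballot n 1) (suc n) ⟩
    ballot n 1                  ∎
  where
  open ≡-Reasoning
  swap : ∀ m b n → suc m * (b * suc n) ≡ suc n * (suc m * b)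
  swap = solve-∀
  ballot*[n+1]≡2nCn : ballot n 1 * suc n ≡ (n + n) C n
  ballot*[n+1]≡2nCn = *-cancelˡ-≡ _ _ (suc (n + n)) (begin
      suc (n + n) * (ballot n 1 * suc n)  ≡⟨ swap (n + n) (ballot n 1) n ⟩
      suc n * (suc (n + n) * ballot n 1)  ≡⟨ cong (suc n *_) (ballot-closed-form n 1) ⟩
      suc n * (1 * (suc (n + n) C n))     ≡⟨ cong (suc n *_) (*-identityˡ _) ⟩
      suc n * (suc (n + n) C n)           ≡⟨ [m+1]*[m+n+1]C[m+1]≡[n+1]*[m+n+1]Cm n n ⟨
      suc n * (suc (n + n) C suc n)       ≡⟨ [k+1]*[n+1]C[k+1]≡[n+1]*nCk (n + n) n ⟩
      suc (n + n) * ((n + n) C n)         ∎)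

-- Validity of trees and forests

∧-cong-T : ∀ a {b c} → (T a → b ≡ c) → a ∧ b ≡ a ∧ c
∧-cong-T true  b≡c = b≡c _
∧-cong-T false _   = refl

okLabel⇒2≤ᵇcompSize : ∀ x y ys → T (okLabel (x ∷ y ∷ ys)) → T (2 ≤ᵇ compSize (x ∷ y ∷ ys))
okLabel⇒2≤ᵇcompSize (suc x) (suc y) ys _ rewrite +-suc x (y + compSize ys) = _

okColor-cong : ∀ {c c′} col ts → T (2 ≤ᵇ compSize c) → T (2 ≤ᵇ compSize c′) → okColor c col ts ≡ okColor c′ col ts
okColor-cong col []      _ _  = refl
okColor-cong col (_ ∷ _) h h′ rewrite to T-≡ h | to T-≡ h′ = refl

okTree-relabel : ∀ c c′ col ts → okLabel c ≡ okLabel c′ →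
                 (T (okLabel c) → T (2 ≤ᵇ compSize c) × T (2 ≤ᵇ compSize c′)) →
                 okTree (node c col ts) ≡ okTree (node c′ col ts)
okTree-relabel c c′ col ts same-label large = trans
  (∧-cong-T (okLabel c) λ ok → cong (λ b → okArity ts ∧ b ∧ okChildren ts)
                                    (okColor-cong col ts (proj₁ (large ok)) (proj₂ (large ok))))
  (cong (_∧ (okArity ts ∧ okColor c′ col ts ∧ okChildren ts)) same-label)

okTree-1∷ : ∀ x y ys col ts → okTree (node (1 ∷ x ∷ y ∷ ys) col ts) ≡ okTree (node (x ∷ y ∷ ys) col ts)
okTree-1∷ x y ys col ts = okTree-relabel (1 ∷ x ∷ y ∷ ys) (x ∷ y ∷ ys) col ts refl
  λ ok → okLabel⇒2≤ᵇcompSize 1 x (y ∷ ys) ok , okLabel⇒2≤ᵇcompSize x y ys ok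

okTree-suc∷ : ∀ a y ys col ts → okTree (node (suc (suc a) ∷ y ∷ ys) col ts) ≡ okTree (node (suc a ∷ y ∷ ys) col ts)
okTree-suc∷ a y ys col ts = okTree-relabel (suc (suc a) ∷ y ∷ ys) (suc a ∷ y ∷ ys) col ts refl
  λ ok → okLabel⇒2≤ᵇcompSize (suc (suc a)) y ys ok , okLabel⇒2≤ᵇcompSize (suc a) y ys ok

okTree⇒okChildren : ∀ c col ts → T (okTree (node c col ts)) → T (okChildren ts)
okTree⇒okChildren c col ts ok =
  proj₂ (to (T-∧ {okColor c col ts}) (proj₂ (to (T-∧ {okArity ts}) (proj₂ (to (T-∧ {okLabel c}) ok)))))

unitLeaf : Tree
unitLeaf = node (1 ∷ []) nothing []

-- The clauses are ordered so that isUnitLeaf computes to false on any node with two label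
-- parts or with children, without inspecting the remaining fields.
isUnitLeaf : Tree → Bool
isUnitLeaf (node (_ ∷ _ ∷ _) _ _)  = false
isUnitLeaf (node _ _ (_ ∷ _))      = false
isUnitLeaf (node (a ∷ []) col [])  = (a ≡ᵇ 1) ∧ is-nothing col
isUnitLeaf _                       = false

isUnitLeaf⇒≡unitLeaf : ∀ t → T (isUnitLeaf t) → t ≡ unitLeaf
isUnitLeaf⇒≡unitLeaf (node (1 ∷ []) nothing [])  _ = refl
isUnitLeaf⇒≡unitLeaf (node [] _ (_ ∷ _))         ()
isUnitLeaf⇒≡unitLeaf (node (_ ∷ []) _ (_ ∷ _))   ()
isUnitLeaf⇒≡unitLeaf (node (1 ∷ []) (just _) []) ()

noTrailingUnitLeaf : Forest → Bool
noTrailingUnitLeaf []           = true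
noTrailingUnitLeaf (t ∷ [])     = not (isUnitLeaf t)
noTrailingUnitLeaf (_ ∷ t ∷ ts) = noTrailingUnitLeaf (t ∷ ts)

rightLeafOK≡not-isUnitLeaf : ∀ t → T (okTree t) → rightLeafOK t ≡ not (isUnitLeaf t)
rightLeafOK≡not-isUnitLeaf (node (1 ∷ []) nothing [])    _  = refl
rightLeafOK≡not-isUnitLeaf (node (x ∷ y ∷ ys) _ [])      ok = to T-≡ (okLabel⇒2≤ᵇcompSize x y ys (proj₁ (to T-∧ ok)))
rightLeafOK≡not-isUnitLeaf (node (_ ∷ _ ∷ _) _ (_ ∷ _))  _  = refl
rightLeafOK≡not-isUnitLeaf (node (1 ∷ []) _ (_ ∷ _))     _  = refl

okChildren≡okForest∧noTrailingUnitLeaf : ∀ g → okChildren g ≡ okForest g ∧ noTrailingUnitLeaf g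
okChildren≡okForest∧noTrailingUnitLeaf []           = refl
okChildren≡okForest∧noTrailingUnitLeaf (t ∷ [])     = begin
    okTree t ∧ rightLeafOK t ∧ true         ≡⟨ cong (okTree t ∧_) (∧-identityʳ _) ⟩
    okTree t ∧ rightLeafOK t                ≡⟨ ∧-cong-T (okTree t) (rightLeafOK≡not-isUnitLeaf t) ⟩
    okTree t ∧ not (isUnitLeaf t)           ≡⟨ ∧-assoc (okTree t) true _ ⟨
    (okTree t ∧ true) ∧ not (isUnitLeaf t)  ∎
  where open ≡-Reasoning
okChildren≡okForest∧noTrailingUnitLeaf (t ∷ u ∷ us) =
  trans (cong (okTree t ∧_) (okChildren≡okForest∧noTrailingUnitLeaf (u ∷ us))) (sym (∧-assoc (okTree t) _ _))

okChildren⇒okForest : ∀ g → T (okChildren g) → T (okForest g)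
okChildren⇒okForest g ok = proj₁ (to T-∧ (subst T (okChildren≡okForest∧noTrailingUnitLeaf g) ok))

okChildren⇒noTrailingUnitLeaf : ∀ g → T (okChildren g) → T (noTrailingUnitLeaf g)
okChildren⇒noTrailingUnitLeaf g ok = proj₂ (to T-∧ (subst T (okChildren≡okForest∧noTrailingUnitLeaf g) ok))

okForest-++ : ∀ f g → okForest (f ++ g) ≡ okForest f ∧ okForest g
okForest-++ []      g = refl
okForest-++ (t ∷ f) g = trans (cong (okTree t ∧_) (okForest-++ f g)) (sym (∧-assoc (okTree t) _ _))

okForest-∷ʳ : ∀ f → T (okForest f) → T (okForest (f ++ unitLeaf ∷ []))
okForest-∷ʳ f ok = subst T (sym (okForest-++ f _)) (from T-∧ (ok , _))

forestSize-++ : ∀ f g → forestSize (f ++ g) ≡ forestSize f + forestSize g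
forestSize-++ []      g = refl
forestSize-++ (t ∷ f) g = trans (cong (treeSize t +_) (forestSize-++ f g)) (sym (+-assoc (treeSize t) _ _))

forestSize-∷ʳ : ∀ f → forestSize (f ++ unitLeaf ∷ []) ≡ suc (forestSize f)
forestSize-∷ʳ f = trans (forestSize-++ f _) (+-comm (forestSize f) 1)

replicate-∷ʳ : ∀ {A : Set} m (x : A) → replicate m x ++ x ∷ [] ≡ x ∷ replicate m x
replicate-∷ʳ zero    x = refl
replicate-∷ʳ (suc m) x = cong (x ∷_) (replicate-∷ʳ m x)

-- Unplanting and planting

prependOne : Tree → Tree
prependOne (node c@(_ ∷ _ ∷ _) col ts) = node (1 ∷ c) col ts
prependOne (node (1 ∷ []) _ ts@(_ ∷ _)) = node (1 ∷ 1 ∷ []) (just bot) ts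
prependOne (node c col ts)              = node (1 ∷ c) col ts

incrementHead : Tree → Tree
incrementHead (node (a ∷ d@(_ ∷ _)) col ts) = node (suc a ∷ d) col ts
incrementHead (node (1 ∷ []) _ ts@(_ ∷ _))   = node (1 ∷ 1 ∷ []) (just top) ts
incrementHead t                              = t

prependOnes : ℕ → Tree → Tree
prependOnes zero    t = t
prependOnes (suc m) t = prependOne (prependOnes m t)

okTree-prependOne : ∀ t → T (okTree t) → T (okTree (prependOne t))
okTree-prependOne (node (x ∷ y ∷ ys) col ts)           ok = subst T (sym (okTree-1∷ x y ys col ts)) ok
okTree-prependOne (node (1 ∷ []) col [])               ok = ok
okTree-prependOne (node (1 ∷ []) nothing (_ ∷ _ ∷ _))  ok = ok

okTree-prependOnes : ∀ m t → T (okTree t) → T (okTree (prependOnes m t))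
okTree-prependOnes zero    t ok = ok
okTree-prependOnes (suc m) t ok = okTree-prependOne (prependOnes m t) (okTree-prependOnes m t ok)

okTree-incrementHead : ∀ t → T (okTree t) → T (not (isUnitLeaf t)) → T (okTree (incrementHead t))
okTree-incrementHead (node (suc a ∷ y ∷ ys) col ts)        ok _ = subst T (sym (okTree-suc∷ a y ys col ts)) ok
okTree-incrementHead (node (1 ∷ []) nothing (_ ∷ _ ∷ _))   ok _ = ok
okTree-incrementHead (node (1 ∷ []) nothing [])            _  ()

-- The wildcard in the second clause is 1 on valid trees: that clause is the label (2) in disguise.
unplant : Tree → Forest
unplant (node (1 ∷ []) _ ts)                      = ts
unplant (node (1 ∷ _ ∷ []) (just top) ts@(_ ∷ _)) = node (1 ∷ []) nothing ts ∷ []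
unplant (node (1 ∷ c@(_ ∷ _)) col ts)             = unplant (node c col ts) ++ unitLeaf ∷ []
unplant (node (suc (suc a) ∷ d) col ts)           = node (suc a ∷ d) col ts ∷ []
unplant _                                         = []

unplant-prependOne : ∀ t → T (okTree t) → unplant (prependOne t) ≡ unplant t ++ unitLeaf ∷ []
unplant-prependOne (node (_ ∷ _ ∷ _) _ _)     _ = refl
unplant-prependOne (node (1 ∷ []) nothing []) _ = refl
unplant-prependOne (node (1 ∷ []) _ (_ ∷ _))  _ = refl

unplant-prependOnes : ∀ m t → T (okTree t) → unplant (prependOnes m t) ≡ unplant t ++ replicate m unitLeaf
unplant-prependOnes zero    t _  = sym (++-identityʳ (unplant t))
unplant-prependOnes (suc m) t ok = begin
    unplant (prependOne (prependOnes m t))               ≡⟨ unplant-prependOne (prependOnes m t) (okTree-prependOnes m t ok) ⟩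
    unplant (prependOnes m t) ++ unitLeaf ∷ []           ≡⟨ cong (_++ unitLeaf ∷ []) (unplant-prependOnes m t ok) ⟩
    (unplant t ++ replicate m unitLeaf) ++ unitLeaf ∷ [] ≡⟨ ++-assoc (unplant t) _ _ ⟩
    unplant t ++ replicate m unitLeaf ++ unitLeaf ∷ []   ≡⟨ cong (unplant t ++_) (replicate-∷ʳ m unitLeaf) ⟩
    unplant t ++ replicate (suc m) unitLeaf              ∎
  where open ≡-Reasoning

unplant-incrementHead : ∀ t → T (okTree t) → T (not (isUnitLeaf t)) → unplant (incrementHead t) ≡ t ∷ []
unplant-incrementHead (node (suc a ∷ _ ∷ _) _ _)            _ _ = refl
unplant-incrementHead (node (1 ∷ []) nothing (_ ∷ _))       _ _ = refl
unplant-incrementHead (node (1 ∷ []) nothing [])            _ ()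
unplant-incrementHead (node (1 ∷ []) (just _) (_ ∷ []))     ()
unplant-incrementHead (node (1 ∷ []) (just _) (_ ∷ _ ∷ _))  ()

okForest-unplant : ∀ t → T (okTree t) → T (okForest (unplant t))
okForest-unplant (node (1 ∷ []) col ts) ok = okChildren⇒okForest ts (okTree⇒okChildren (1 ∷ []) col ts ok)
okForest-unplant (node (1 ∷ 1 ∷ []) (just top) (_ ∷ _)) ok = from T-∧ (ok , _)
okForest-unplant (node (1 ∷ 1 ∷ []) (just bot) ts) ok =
  okForest-∷ʳ ts (okChildren⇒okForest ts (okTree⇒okChildren (1 ∷ 1 ∷ []) (just bot) ts ok))
okForest-unplant (node (1 ∷ 1 ∷ []) nothing ts) ok =
  okForest-∷ʳ ts (okChildren⇒okForest ts (okTree⇒okChildren (1 ∷ 1 ∷ []) nothing ts ok))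
okForest-unplant (node (1 ∷ x ∷ y ∷ ys) col ts) ok =
  okForest-∷ʳ (unplant (node (x ∷ y ∷ ys) col ts))
              (okForest-unplant (node (x ∷ y ∷ ys) col ts) (subst T (okTree-1∷ x y ys col ts) ok))
okForest-unplant (node (suc (suc a) ∷ y ∷ ys) col ts) ok = from T-∧ (subst T (okTree-suc∷ a y ys col ts) ok , _)

forestSize-unplant : ∀ t → T (okTree t) → suc (forestSize (unplant t)) ≡ treeSize t
forestSize-unplant (node (1 ∷ []) _ _)                   _ = refl
forestSize-unplant (node (1 ∷ 1 ∷ []) (just top) (_ ∷ _)) _ = cong suc (+-identityʳ _)
forestSize-unplant (node (1 ∷ 1 ∷ []) (just bot) ts)      _ = cong suc (forestSize-∷ʳ ts)
forestSize-unplant (node (1 ∷ 1 ∷ []) nothing ts)         _ = cong suc (forestSize-∷ʳ ts)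
forestSize-unplant (node (1 ∷ x ∷ y ∷ ys) col ts) ok = cong suc (trans
  (forestSize-∷ʳ (unplant (node (x ∷ y ∷ ys) col ts)))
  (forestSize-unplant (node (x ∷ y ∷ ys) col ts) (subst T (okTree-1∷ x y ys col ts) ok)))
forestSize-unplant (node (suc (suc a) ∷ y ∷ ys) col ts) _ = cong suc (+-identityʳ _)

stripUnitLeaves : Forest → Forest × ℕ
stripUnitLeaves []      = [] , 0
stripUnitLeaves (t ∷ f) with stripUnitLeaves f
... | g@(_ ∷ _) , m = t ∷ g , m
... | [] , m with isUnitLeaf t
...   | true  = [] , suc m
...   | false = t ∷ [] , m

stripUnitLeaves-++ : ∀ f → proj₁ (stripUnitLeaves f) ++ replicate (proj₂ (stripUnitLeaves f)) unitLeaf ≡ f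
stripUnitLeaves-++ []      = refl
stripUnitLeaves-++ (t ∷ f) with stripUnitLeaves f | stripUnitLeaves-++ f
... | _ ∷ _ , _ | f≡ = cong (t ∷_) f≡
... | [] , _    | f≡ with isUnitLeaf t in eq
...   | true  = cong₂ _∷_ (sym (isUnitLeaf⇒≡unitLeaf t (from T-≡ eq))) f≡
...   | false = cong (t ∷_) f≡

stripUnitLeaves-noTrailingUnitLeaf : ∀ f → T (noTrailingUnitLeaf (proj₁ (stripUnitLeaves f)))
stripUnitLeaves-noTrailingUnitLeaf []      = _
stripUnitLeaves-noTrailingUnitLeaf (t ∷ f) with stripUnitLeaves f | stripUnitLeaves-noTrailingUnitLeaf f
... | _ ∷ _ , _ | h = h
... | [] , _    | _ with isUnitLeaf t in eq
...   | true  = _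
...   | false = from T-not-≡ eq

stripUnitLeaves-∷ʳ : ∀ f → stripUnitLeaves (f ++ unitLeaf ∷ []) ≡ (proj₁ (stripUnitLeaves f) , suc (proj₂ (stripUnitLeaves f)))
stripUnitLeaves-∷ʳ []      = refl
stripUnitLeaves-∷ʳ (t ∷ f) rewrite stripUnitLeaves-∷ʳ f with stripUnitLeaves f
... | _ ∷ _ , _ = refl
... | [] , _ with isUnitLeaf t
...   | true  = refl
...   | false = refl

stripUnitLeaves-unchanged : ∀ f → T (noTrailingUnitLeaf f) → stripUnitLeaves f ≡ (f , 0)
stripUnitLeaves-unchanged []           _ = refl
stripUnitLeaves-unchanged (t ∷ [])     h rewrite to T-not-≡ h = refl
stripUnitLeaves-unchanged (t ∷ u ∷ us) h rewrite stripUnitLeaves-unchanged (u ∷ us) h = refl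

okForest-stripUnitLeaves : ∀ f → T (okForest f) → T (okForest (proj₁ (stripUnitLeaves f)))
okForest-stripUnitLeaves f ok =
  proj₁ (to T-∧ (subst T (okForest-++ (proj₁ (stripUnitLeaves f)) _)
                         (subst (T ∘ okForest) (sym (stripUnitLeaves-++ f)) ok)))

join : Forest → Tree
join []            = unitLeaf
join (t ∷ [])      = incrementHead t
join g@(_ ∷ _ ∷ _) = node (1 ∷ []) nothing g

okTree-join : ∀ g → T (okForest g) → T (noTrailingUnitLeaf g) → T (okTree (join g))
okTree-join []            _  _ = _
okTree-join (t ∷ [])      ok h = okTree-incrementHead t (proj₁ (to T-∧ ok)) h
okTree-join g@(_ ∷ _ ∷ _) ok h = subst T (sym (okChildren≡okForest∧noTrailingUnitLeaf g)) (from T-∧ (ok , h))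

unplant-join : ∀ g → T (okForest g) → T (noTrailingUnitLeaf g) → unplant (join g) ≡ g
unplant-join []          _  _ = refl
unplant-join (t ∷ [])    ok h = unplant-incrementHead t (proj₁ (to T-∧ ok)) h
unplant-join (_ ∷ _ ∷ _) _  _ = refl

plant : Forest → Tree
plant f = prependOnes (proj₂ (stripUnitLeaves f)) (join (proj₁ (stripUnitLeaves f)))

plant-∷ʳ : ∀ f → plant (f ++ unitLeaf ∷ []) ≡ prependOne (plant f)
plant-∷ʳ f = cong (λ (g , m) → prependOnes m (join g)) (stripUnitLeaves-∷ʳ f)

plant≡join : ∀ f → T (noTrailingUnitLeaf f) → plant f ≡ join f
plant≡join f h = cong (λ (g , m) → prependOnes m (join g)) (stripUnitLeaves-unchanged f h)

okTree-plant : ∀ f → T (okForest f) → T (okTree (plant f))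
okTree-plant f ok = okTree-prependOnes (proj₂ (stripUnitLeaves f)) (join g)
  (okTree-join g (okForest-stripUnitLeaves f ok) (stripUnitLeaves-noTrailingUnitLeaf f))
  where
  g : Forest
  g = proj₁ (stripUnitLeaves f)

unplant-plant : ∀ f → T (okForest f) → unplant (plant f) ≡ f
unplant-plant f ok = begin
    unplant (prependOnes m (join g))          ≡⟨ unplant-prependOnes m (join g) (okTree-join g okg noTrailing) ⟩
    unplant (join g) ++ replicate m unitLeaf  ≡⟨ cong (_++ replicate m unitLeaf) (unplant-join g okg noTrailing) ⟩
    g ++ replicate m unitLeaf                 ≡⟨ stripUnitLeaves-++ f ⟩
    f                                         ∎
  where
  open ≡-Reasoning
  g : Forest
  g = proj₁ (stripUnitLeaves f)
  m : ℕ
  m = proj₂ (stripUnitLeaves f)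
  okg : T (okForest g)
  okg = okForest-stripUnitLeaves f ok
  noTrailing : T (noTrailingUnitLeaf g)
  noTrailing = stripUnitLeaves-noTrailingUnitLeaf f

plant-unplant : ∀ t → T (okTree t) → plant (unplant t) ≡ t
plant-unplant (node (1 ∷ []) nothing [])               _  = refl
plant-unplant (node (1 ∷ []) nothing ts@(_ ∷ _ ∷ _))   ok = plant≡join ts (okChildren⇒noTrailingUnitLeaf ts ok)
plant-unplant (node (1 ∷ 1 ∷ []) (just top) (_ ∷ _))   _  = refl
plant-unplant (node (1 ∷ 1 ∷ []) (just bot) ts@(_ ∷ _)) ok =
  trans (plant-∷ʳ ts) (cong prependOne (plant-unplant (node (1 ∷ []) nothing ts) ok))
plant-unplant (node (1 ∷ 1 ∷ []) nothing [])           _  = refl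
plant-unplant (node (1 ∷ 1 ∷ []) nothing (_ ∷ []))     ()
plant-unplant (node (1 ∷ 1 ∷ []) nothing (_ ∷ _ ∷ _))  ()
plant-unplant (node (1 ∷ x ∷ y ∷ ys) col ts) ok = trans
  (plant-∷ʳ (unplant (node (x ∷ y ∷ ys) col ts)))
  (cong prependOne (plant-unplant (node (x ∷ y ∷ ys) col ts) (subst T (okTree-1∷ x y ys col ts) ok)))
plant-unplant (node (suc (suc a) ∷ y ∷ ys) col ts) _ = refl

treeSize-plant : ∀ f → T (okForest f) → treeSize (plant f) ≡ suc (forestSize f)
treeSize-plant f ok = begin
    treeSize (plant f)                    ≡⟨ forestSize-unplant (plant f) (okTree-plant f ok) ⟨
    suc (forestSize (unplant (plant f)))  ≡⟨ cong (suc ∘ forestSize) (unplant-plant f ok) ⟩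
    suc (forestSize f)                    ∎
  where open ≡-Reasoning

-- Counting tuples of forests

×-irrelevant : ∀ {A B : Set} → Irrelevant A → Irrelevant B → Irrelevant (A × B)
×-irrelevant irrA irrB (a , b) (a′ , b′) = cong₂ _,_ (irrA a a′) (irrB b b′)

Σ-≡-by-proj₁ : ∀ {A : Set} {P : A → Set} → (∀ {a} → Irrelevant (P a)) →
               {x y : Σ A P} → proj₁ x ≡ proj₁ y → x ≡ y
Σ-≡-by-proj₁ irr {a , p} {.a , q} refl = cong (a ,_) (irr p q)

LCOForest≡ : ∀ {n} {x y : LCOForestOfSize n} → proj₁ x ≡ proj₁ y → x ≡ y
LCOForest≡ = Σ-≡-by-proj₁ (×-irrelevant T-irrelevant ≡-irrelevant)

LCOTree≡ : ∀ {n} {x y : LCOTreeForestOfSize n} → proj₁ x ≡ proj₁ y → x ≡ y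
LCOTree≡ = Σ-≡-by-proj₁ (×-irrelevant T-irrelevant (×-irrelevant ≡-irrelevant ≡-irrelevant))

LCOTree↔LCOForest : ∀ n → LCOTreeForestOfSize (suc n) ↔ LCOForestOfSize n
LCOTree↔LCOForest n = mk↔ₛ′ to′ from′ (λ (f , ok , _) → LCOForest≡ (unplant-plant f ok))
                                         λ { (t ∷ [] , ok , _) → LCOTree≡ (cong (_∷ []) (plant-unplant t (proj₁ (to T-∧ ok)))) }
  where
  to′ : LCOTreeForestOfSize (suc n) → LCOForestOfSize n
  to′ (t ∷ [] , ok , size , _) = unplant t , okForest-unplant t okt ,
    suc-injective (trans (forestSize-unplant t okt) (trans (sym (+-identityʳ _)) size))
    where
    okt : T (okTree t)
    okt = proj₁ (to T-∧ ok)
  from′ : LCOForestOfSize n → LCOTreeForestOfSize (suc n)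
  from′ (f , ok , size) = plant f ∷ [] , from T-∧ (okTree-plant f ok , _) ,
    trans (+-identityʳ _) (trans (treeSize-plant f ok) (cong suc size)) , refl

okForests : ∀ {k} → Vec Forest k → Bool
okForests []       = true
okForests (f ∷ fs) = okForest f ∧ okForests fs

forestsSize : ∀ {k} → Vec Forest k → ℕ
forestsSize []       = 0
forestsSize (f ∷ fs) = forestSize f + forestsSize fs

ForestTuples : ℕ → ℕ → Set
ForestTuples n k = Σ (Vec Forest k) λ fs → T (okForests fs) × forestsSize fs ≡ n

ForestTuples≡ : ∀ {n k} {x y : ForestTuples n k} → proj₁ x ≡ proj₁ y → x ≡ y
ForestTuples≡ = Σ-≡-by-proj₁ (×-irrelevant T-irrelevant ≡-irrelevant)

LCOForest↔ForestTuples : ∀ n → LCOForestOfSize n ↔ ForestTuples n 1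
LCOForest↔ForestTuples n = mk↔ₛ′ to′ from′ (λ { (_ ∷ [] , _) → ForestTuples≡ refl }) (λ _ → LCOForest≡ refl)
  where
  to′ : LCOForestOfSize n → ForestTuples n 1
  to′ (f , ok , size) = f ∷ [] , from T-∧ (ok , _) , trans (+-identityʳ _) size
  from′ : ForestTuples n 1 → LCOForestOfSize n
  from′ (f ∷ [] , ok , size) = f , proj₁ (to T-∧ ok) , trans (sym (+-identityʳ _)) size

treeSize-nonzero : ∀ t → T (okTree t) → treeSize t ≢ 0
treeSize-nonzero t ok size≡0 = 0≢1+n (trans (sym size≡0) (sym (forestSize-unplant t ok)))

okForest-size0⇒≡[] : ∀ f → T (okForest f) → forestSize f ≡ 0 → f ≡ []
okForest-size0⇒≡[] []      _  _    = refl
okForest-size0⇒≡[] (t ∷ f) ok size = ⊥-elim (treeSize-nonzero t (proj₁ (to T-∧ ok)) (m+n≡0⇒m≡0 _ size))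

ForestTuples-size0-empty : ∀ {k} (x : ForestTuples 0 k) → proj₁ x ≡ Vec.replicate k []
ForestTuples-size0-empty ([] , _) = refl
ForestTuples-size0-empty (f ∷ fs , ok , size) = cong₂ _∷_
  (okForest-size0⇒≡[] f (proj₁ (to T-∧ ok)) (m+n≡0⇒m≡0 _ size))
  (ForestTuples-size0-empty (fs , proj₂ (to T-∧ ok) , m+n≡0⇒n≡0 (forestSize f) size))

emptyForestTuple : ∀ k → ForestTuples 0 k
emptyForestTuple zero    = [] , _ , refl
emptyForestTuple (suc k) with emptyForestTuple k
... | fs , ok , size = [] ∷ fs , ok , size

ForestTuples-size0↔Fin1 : ∀ k → ForestTuples 0 k ↔ Fin 1
ForestTuples-size0↔Fin1 k = mk↔ₛ′ (λ _ → zero) (λ _ → emptyForestTuple k) (λ { zero → refl })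
  λ x → ForestTuples≡ (trans (ForestTuples-size0-empty (emptyForestTuple k)) (sym (ForestTuples-size0-empty x)))

ForestTuples-length0↔Fin0 : ∀ n → ForestTuples (suc n) 0 ↔ Fin 0
ForestTuples-length0↔Fin0 n = mk↔ₛ′ (λ { ([] , _ , ()) }) (λ ()) (λ ()) (λ { ([] , _ , ()) })

okForests-∷∷ : ∀ t g {k} (fs : Vec Forest k) → okForests ((t ∷ g) ∷ fs) ≡ okTree t ∧ okForests (g ∷ fs)
okForests-∷∷ t g fs = ∧-assoc (okTree t) (okForest g) (okForests fs)

ForestTuples-split : ∀ n k → ForestTuples (suc n) (suc k) ↔ (ForestTuples (suc n) k ⊎ ForestTuples n (suc (suc k)))
ForestTuples-split n k = mk↔ₛ′ to′ from′ to∘from from∘to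
  where
  okTree-head : ∀ t g (fs : Vec Forest k) → T (okForests ((t ∷ g) ∷ fs)) → T (okTree t) × T (okForests (g ∷ fs))
  okTree-head t g fs ok = to T-∧ (subst T (okForests-∷∷ t g fs) ok)

  to′ : ForestTuples (suc n) (suc k) → ForestTuples (suc n) k ⊎ ForestTuples n (suc (suc k))
  to′ ([] ∷ fs , ok , size) = inj₁ (fs , ok , size)
  to′ ((t ∷ g) ∷ fs , ok , size) = inj₂ (unplant t ∷ g ∷ fs ,
      from T-∧ (okForest-unplant t okt , proj₂ (okTree-head t g fs ok)) ,
      trans (sym (+-assoc (forestSize (unplant t)) _ _))
            (suc-injective (trans (cong (λ s → s + forestSize g + forestsSize fs) (forestSize-unplant t okt)) size)))
    where
    okt : T (okTree t)
    okt = proj₁ (okTree-head t g fs ok)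
  from′ : ForestTuples (suc n) k ⊎ ForestTuples n (suc (suc k)) → ForestTuples (suc n) (suc k)
  from′ (inj₁ (fs , ok , size)) = [] ∷ fs , ok , size
  from′ (inj₂ (h ∷ g ∷ fs , ok , size)) = (plant h ∷ g) ∷ fs ,
      subst T (sym (okForests-∷∷ (plant h) g fs)) (from T-∧ (okTree-plant h okh , proj₂ (to (T-∧ {okForest h}) ok))) ,
      trans (cong (λ s → s + forestSize g + forestsSize fs) (treeSize-plant h okh))
            (cong suc (trans (+-assoc (forestSize h) _ _) size))
    where
    okh : T (okForest h)
    okh = proj₁ (to (T-∧ {okForest h}) ok)
  to∘from : ∀ y → to′ (from′ y) ≡ y
  to∘from (inj₁ _) = refl
  to∘from (inj₂ (h ∷ g ∷ fs , ok , _)) =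
    cong inj₂ (ForestTuples≡ (cong (λ f → f ∷ g ∷ fs) (unplant-plant h (proj₁ (to T-∧ ok)))))
  from∘to : ∀ x → from′ (to′ x) ≡ x
  from∘to ([] ∷ _ , _) = refl
  from∘to ((t ∷ g) ∷ fs , ok , _) =
    ForestTuples≡ (cong (λ u → (u ∷ g) ∷ fs) (plant-unplant t (proj₁ (okTree-head t g fs ok))))

ForestTuples↔ballot : ∀ n k → ForestTuples n k ↔ Fin (ballot n k)
ForestTuples↔ballot zero    k       = ForestTuples-size0↔Fin1 k
ForestTuples↔ballot (suc n) zero    = ForestTuples-length0↔Fin0 n
ForestTuples↔ballot (suc n) (suc k) =
  ↔-trans (ForestTuples-split n k)
          (↔-trans (ForestTuples↔ballot (suc n) k ⊎-↔ ForestTuples↔ballot n (suc (suc k))) (↔-sym +↔⊎))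

Fin-catalan↔LCOForest : ∀ n → Fin (catalan n) ↔ LCOForestOfSize n
Fin-catalan↔LCOForest n rewrite catalan≡ballot n =
  ↔-sym (↔-trans (LCOForest↔ForestTuples n) (ForestTuples↔ballot n 1))

proposition9 : (n : ℕ) →
    (Fin (catalan n) ↔ LCOForestOfSize n) × (Fin (catalan n) ↔ LCOTreeForestOfSize (suc n))
proposition9 n = Fin-catalan↔LCOForest n , ↔-trans (Fin-catalan↔LCOForest n) (↔-sym (LCOTree↔LCOForest n))
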